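{- Let $G$ be a finite simple undirected connected AT-free graph of girth at least $5$, let $x,y$ be a dominating pair of $G$ with $\mathrm{dist}(x,y)$ equal to the diameter of $G$, and let $P$ be a shortest $x$-$y$ path with vertices $u_1=x,u_2,\dots,u_d=y$ in order. For $1\le i\le d$ let $S_i=\{v\in V(G)\setminus V(P) : u_i\in N_G(v)\}$. Let $1\le i\le d-2$, $u\in S_i$ and $v\in S_{i+2}$ with $(u,v)\in E(G)$. Then for every $p\in S_i\setminus\{u\}$ and every $q\in S_{i+2}\setminus\{v\}$ we have $(p,q)\notin E(G)$.
   Context: $G$ is AT-free if it has no asteroidal triple (independent set of three vertices such that between each pair there is a path avoiding the neighbourhood of the third). A pair $x,y$ is a dominating pair if the vertex set of every $x$-$y$ path is a dominating set (every other vertex has a neighbour on the path). $N_G(v)$ is the neighbourhood of $v$. -}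

module Defs where

open import Data.Nat using (ℕ; zero; suc; _≤_; _<_; _+_)
open import Data.Fin using (Fin)
open import Data.List using (List; []; _∷_; length; head; last; lookup)
open import Data.List.Relation.Unary.All using (All)
open import Data.List.Relation.Unary.Any using (Any)
open import Data.List.Relation.Unary.Unique.Propositional using (Unique)
open import Data.List.Membership.Propositional using (_∈_; _∉_)
open import Data.Maybe using (just)
open import Data.Product using (Σ; _×_; ∃)
open import Relation.Binary.PropositionalEquality using (_≡_; _≢_)
open import Relation.Nullary using (¬_)
open import Data.Empty using (⊥)
import Data.Nat.Properties

record Graph (n : ℕ) : Set₁ where
  field
    Adj    : Fin n → Fin n → Set
    sym    : ∀ {a b} → Adj a b → Adj b a
    irrefl : ∀ {a} → ¬ Adj a a

module _ {n : ℕ} (G : Graph n) where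
  open Graph G

  data Chain : List (Fin n) → Set where
    []  : Chain []
    [-] : ∀ {a} → Chain (a ∷ [])
    _∷_ : ∀ {a b rest} → Adj a b → Chain (b ∷ rest) → Chain (a ∷ b ∷ rest)

  IsPath : Fin n → Fin n → List (Fin n) → Set
  IsPath a b p = (head p ≡ just a) × (last p ≡ just b) × Chain p × Unique p

  Connected : Set
  Connected = ∀ a b → ∃ λ p → IsPath a b p

  -- dist(a,b) = k : there is an a-b path with k edges and none with fewer
  Dist : Fin n → Fin n → ℕ → Set
  Dist a b k = (∃ λ p → IsPath a b p × length p ≡ suc k)
             × (∀ p → IsPath a b p → suc k ≤ length p)

  IsCycle : List (Fin n) → Set
  IsCycle c = (3 ≤ length c) × Chain c × Unique c
            × ∃ λ a → ∃ λ b → (head c ≡ just a) × (last c ≡ just b) × Adj b a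

  GirthAtLeast : ℕ → Set
  GirthAtLeast g = ∀ c → IsCycle c → g ≤ length c

  AvoidsN : Fin n → List (Fin n) → Set
  AvoidsN z p = All (λ w → ¬ Adj w z) p

  AsteroidalTriple : Fin n → Fin n → Fin n → Set
  AsteroidalTriple a b c =
    (a ≢ b) × (b ≢ c) × (a ≢ c) ×
    (¬ Adj a b) × (¬ Adj b c) × (¬ Adj a c) ×
    (∃ λ p → IsPath a b p × AvoidsN c p) ×
    (∃ λ p → IsPath b c p × AvoidsN a p) ×
    (∃ λ p → IsPath a c p × AvoidsN b p)

  ATFree : Set
  ATFree = ∀ a b c → ¬ AsteroidalTriple a b c

  DominatingPair : Fin n → Fin n → Set
  DominatingPair x y = ∀ p → IsPath x y p → ∀ w → w ∉ p → Any (Adj w) p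

  -- v ∈ S_i  (0-based index i into the path P)
  InS : (P : List (Fin n)) → Fin (length P) → Fin n → Set
  InS P i v = (v ∉ P) × Adj v (lookup P i)

≤-helper : ∀ {i m} → i + 2 < m → i < m
≤-helper {i} h = Data.Nat.Properties.≤-trans (Data.Nat.s≤s (Data.Nat.Properties.m≤m+n i 2)) h

module Submission where

-- Write a = u_i and c = u_{i+2}.  If p–q were an edge as well
-- as u–v, the vertices a, u, v, c, q, p would close up into a hexagon
--     a – u – v – c – q – p – a .
-- In a graph of girth at least 5 there are no triangles and no 4-cycles,
-- so this hexagon has no chords, and the three vertices a, v, q form an
-- asteroidal triple: a–u–v avoids N(q), v–c–q avoids N(a) and a–p–q
-- avoids N(v).  This contradicts AT-freeness.

open import Defs
open import Data.Nat using (ℕ; suc; _≤_; _<_; _+_; s≤s; z≤n)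
open import Data.Fin using (Fin; fromℕ<)
open import Data.List using (List; length; []; _∷_; lookup)
open import Data.Product using (_,_)
open import Relation.Binary.PropositionalEquality using (_≡_; _≢_; refl; sym)
open import Relation.Nullary using (¬_)
open import Data.Empty using (⊥)
open import Data.List.Relation.Unary.All using ([]; _∷_)
open import Data.List.Relation.Unary.AllPairs using ([]; _∷_)
open import Data.List.Membership.Propositional using (_∉_)
open import Data.List.Membership.Propositional.Properties using (∈-lookup)

module _ {n : ℕ} (G : Graph n) where
  open Graph G renaming (sym to adj-sym)

  adj⇒≢ : ∀ {a b} → Adj a b → a ≢ b
  adj⇒≢ ab refl = irrefl ab

  lookup-≢ : ∀ {P : List (Fin n)} {w} i → w ∉ P → lookup P i ≢ w
  lookup-≢ i w∉P refl = w∉P (∈-lookup i)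

  path₃ : ∀ {a b c} → Adj a b → Adj b c → a ≢ c → IsPath G a c (a ∷ b ∷ c ∷ [])
  path₃ ab bc a≢c =
    refl , refl , ab ∷ (bc ∷ [-]) ,
    (adj⇒≢ ab ∷ a≢c ∷ []) ∷ (adj⇒≢ bc ∷ []) ∷ [] ∷ []

  module _ (girth≥5 : GirthAtLeast G 5) where

    no-triangle : ∀ {a b c} → Adj a b → Adj b c → Adj c a → ⊥
    no-triangle {a} {b} {c} ab bc ca
      with girth≥5 (a ∷ b ∷ c ∷ [])
             ( s≤s (s≤s (s≤s z≤n)) , ab ∷ (bc ∷ [-])
             , (adj⇒≢ ab ∷ (λ a≡c → adj⇒≢ ca (sym a≡c)) ∷ [])
               ∷ (adj⇒≢ bc ∷ []) ∷ [] ∷ []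
             , a , c , refl , refl , ca )
    ... | s≤s (s≤s (s≤s ()))

    no-square : ∀ {a b c d} → Adj a b → Adj b c → Adj c d → Adj d a →
                a ≢ c → b ≢ d → ⊥
    no-square {a} {b} {c} {d} ab bc cd da a≢c b≢d
      with girth≥5 (a ∷ b ∷ c ∷ d ∷ [])
             ( s≤s (s≤s (s≤s z≤n)) , ab ∷ (bc ∷ (cd ∷ [-]))
             , (adj⇒≢ ab ∷ a≢c ∷ (λ a≡d → adj⇒≢ da (sym a≡d)) ∷ [])
               ∷ (adj⇒≢ bc ∷ b≢d ∷ []) ∷ (adj⇒≢ cd ∷ []) ∷ [] ∷ []
             , a , d , refl , refl , da )
    ... | s≤s (s≤s (s≤s (s≤s ())))

    -- An AT-free graph of girth at least 5 contains no hexagon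
    -- a – u – v – c – q – p – a  (under the listed distinctness conditions):
    -- otherwise a, v, q would be an asteroidal triple.
    no-hexagon : ATFree G →
      ∀ {a u v c q p} →
      Adj a u → Adj u v → Adj v c → Adj c q → Adj q p → Adj p a →
      p ≢ u → q ≢ v → a ≢ v → a ≢ q → c ≢ u → c ≢ q → ⊥
    no-hexagon at-free {a} {u} {v} {c} {q} {p} au uv vc cq qp pa
               p≢u q≢v a≢v a≢q c≢u c≢q =
      at-free a v q
        ( a≢v , v≢q , a≢q
        , a≁v , v≁q , a≁q
        , (a ∷ u ∷ v ∷ [] , path₃ au uv a≢v , a≁q ∷ u≁q ∷ v≁q ∷ [])
        , (v ∷ c ∷ q ∷ [] , path₃ vc cq v≢q
          , (λ va → a≁v (adj-sym va)) ∷ c≁a ∷ (λ qa → a≁q (adj-sym qa)) ∷ [])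
        , (a ∷ p ∷ q ∷ [] , path₃ (adj-sym pa) (adj-sym qp) a≢q
          , a≁v ∷ p≁v ∷ (λ qv → v≁q (adj-sym qv)) ∷ [])
        )
      where
        v≢q : v ≢ q
        v≢q v≡q = q≢v (sym v≡q)
        -- Chords of the hexagon would create triangles or squares.
        a≁v : ¬ Adj a v
        a≁v av = no-triangle au uv (adj-sym av)
        v≁q : ¬ Adj v q
        v≁q vq = no-triangle vc cq (adj-sym vq)
        a≁q : ¬ Adj a q
        a≁q aq = no-triangle aq qp pa
        u≁q : ¬ Adj u q
        u≁q uq = no-square (adj-sym au) (adj-sym pa) (adj-sym qp) (adj-sym uq)
                           (λ u≡p → p≢u (sym u≡p)) a≢q
        c≁a : ¬ Adj c a
        c≁a ca = no-square au uv vc ca a≢v (λ u≡c → c≢u (sym u≡c))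
        p≁v : ¬ Adj p v
        p≁v pv = no-square pa au uv (adj-sym pv) p≢u a≢v

lemma4 : (n : ℕ) (G : Graph n) → Connected G → ATFree G → GirthAtLeast G 5 →
    (x y : Fin n) → DominatingPair G x y →
    (k : ℕ) → Dist G x y k → (∀ a b m → Dist G a b m → m ≤ k) →
    (P : List (Fin n)) → IsPath G x y P → length P ≡ suc k →
    (i : ℕ) (hi : i + 2 < length P) →
    (u v : Fin n) →
    InS G P (fromℕ< {i} (≤-helper hi)) u → InS G P (fromℕ< hi) v →
    Graph.Adj G u v →
    (p q : Fin n) →
    InS G P (fromℕ< {i} (≤-helper hi)) p → p ≢ u →
    InS G P (fromℕ< hi) q → q ≢ v →
    ¬ Graph.Adj G p q
lemma4 n G _ at-free girth≥5 x y _ k _ _ P _ _ i hi u v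
       (u∉P , ua) (v∉P , vc) uv p q (p∉P , pa) p≢u (q∉P , qc) q≢v pq =
  no-hexagon G girth≥5 at-free
    (adj-sym ua) uv vc (adj-sym qc) (adj-sym pq) pa
    p≢u q≢v
    (lookup-≢ G i₀ v∉P) (lookup-≢ G i₀ q∉P)
    (lookup-≢ G i₂ u∉P) (lookup-≢ G i₂ q∉P)
  where
    open Graph G renaming (sym to adj-sym)
    i₀ : Fin (length P)
    i₀ = fromℕ< {i} (≤-helper hi)
    i₂ : Fin (length P)
    i₂ = fromℕ< hi
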